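{- Let $q$ be a prime power, $r,k,s$ integers with $0\le k\le r-1$ and $s\ge r-k$, and $0<d\le 1$. Then $$P_q(r,k,s,d)\le \frac{1-\pi_{q,r,k}}{d}.$$
   Context: A random $r\times s$ matrix over $\mathbb{F}_q$ is one whose columns are chosen independently and uniformly at random from the nonzero vectors of $\mathbb{F}_q^r$. For an $r\times s$ matrix and an integer $k\ge 0$, its $k$-dependence is the proportion of the size-$(r-k)$ subsets of its columns (as a multiset) that are linearly dependent. $P_q(r,k,s,d)$ denotes the smallest $p$ such that, with probability at least $1-p$, a random $r\times s$ matrix over $\mathbb{F}_q$ has $k$-dependence $\le d$. $\pi_{q,r,k}$ denotes the probability that $r-k$ nonzero vectors chosen independently and uniformly at random from $\mathbb{F}_q^r\setminus\{0\}$ are linearly independent.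
   Formalization: The parameter d ranges over the rationals in the interval $0<d\le 1$. -}

module Defs where

open import Data.Nat as ℕ using (ℕ; zero; suc)
open import Data.Fin using (Fin; zero; suc)
open import Data.Bool using (Bool; true; false; not; _∧_; if_then_else_)
open import Data.List using (List; []; _∷_; [_]; map; _++_; concatMap; filter; length)
open import Data.Bool.ListAction using (any)
open import Data.List.Membership.Propositional using (_∈_)
open import Data.List.Relation.Unary.Unique.Propositional using (Unique)
open import Data.Product using (∃)
open import Data.Integer using (+_)
open import Data.Rational using (ℚ; 0ℚ; 1ℚ; _-_; _<_)
import Data.Rational as ℚ
open import Relation.Binary.PropositionalEquality using (_≡_; _≢_)
open import Relation.Binary.Definitions using (DecidableEquality)
open import Relation.Nullary.Decidable using (does)
open import Algebra.Structures using (IsCommutativeRing)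

-- Its order q = length elements is then necessarily a prime power.

record FiniteField : Set₁ where
  infixl 7 _*_
  infixl 6 _+_
  field
    Carrier  : Set
    _+_ _*_  : Carrier → Carrier → Carrier
    -_       : Carrier → Carrier
    0# 1#    : Carrier
    isCommutativeRing : IsCommutativeRing _≡_ _+_ _*_ -_ 0# 1#
    0≢1      : 0# ≢ 1#
    inverse  : ∀ x → x ≢ 0# → ∃ λ y → x * y ≡ 1#
    _≟_      : DecidableEquality Carrier
    elements : List Carrier
    complete : ∀ x → x ∈ elements
    unique   : Unique elements

  order : ℕ
  order = length elements

tuples : ∀ {A : Set} → List A → (n : ℕ) → List (Fin n → A)
tuples xs zero    = [ (λ ()) ]
tuples xs (suc n) = concatMap (λ x → map (λ f → cons x f) (tuples xs n)) xs
  where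
  cons : ∀ {A : Set} {n} → A → (Fin n → A) → Fin (suc n) → A
  cons x f zero    = x
  cons x f (suc i) = f i

-- all size-m subsets of Fin s, each given as its strictly increasing
-- enumeration Fin m → Fin s (so there are exactly (s choose m) of them)
subsets : (s m : ℕ) → List (Fin m → Fin s)
subsets s       zero    = [ (λ ()) ]
subsets zero    (suc m) = []
subsets (suc s) (suc m) =
  map (λ f → λ { zero → zero ; (suc i) → suc (f i) }) (subsets s m)
  ++ map (λ f → λ i → suc (f i)) (subsets s (suc m))

count : ∀ {A : Set} → (A → Bool) → List A → ℕ
count p xs = length (filter (λ x → Data.Bool._≟_ (p x) true) xs)
  where import Data.Bool

-- the proportion a / b as a rational (0 if b = 0)
ratio : ℕ → ℕ → ℚ
ratio a zero    = 0ℚ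
ratio a (suc b) = (+ a) ℚ./ suc b

module _ (F : FiniteField) where
  open FiniteField F

  Vector : ℕ → Set
  Vector r = Fin r → Carrier

  isZero : Carrier → Bool
  isZero x = does (x ≟ 0#)

  allZero : ∀ {n} → (Fin n → Carrier) → Bool
  allZero {zero}  v = true
  allZero {suc n} v = isZero (v zero) ∧ allZero (λ i → v (suc i))

  zeroV : ∀ {r} → Vector r
  zeroV _ = 0#

  lincomb : ∀ {r m} → (Fin m → Carrier) → (Fin m → Vector r) → Vector r
  lincomb {m = zero}  c v = zeroV
  lincomb {m = suc m} c v j = c zero * v zero j + lincomb (λ i → c (suc i)) (λ i → v (suc i)) j

  linDependent : ∀ {r m} → (Fin m → Vector r) → Bool
  linDependent {m = m} v =
    any (λ c → not (allZero c) ∧ allZero (lincomb c v)) (tuples elements m)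

  linIndependent : ∀ {r m} → (Fin m → Vector r) → Bool
  linIndependent v = not (linDependent v)

  nonzeroVectors : (r : ℕ) → List (Vector r)
  nonzeroVectors r = filter (λ v → Data.Bool._≟_ (allZero v) false) (tuples elements r)
    where import Data.Bool

  -- the sample space of random r × s matrices: all s-tuples of nonzero
  -- columns, each equally likely
  matrices : (r s : ℕ) → List (Fin s → Vector r)
  matrices r s = tuples (nonzeroVectors r) s

  -- k-dependence of an r × s matrix M (given by its columns): proportion of
  -- the size-(r-k) subsets of the columns (subsets of column positions,
  -- i.e. as a multiset) that are linearly dependent
  kDependence : ∀ {r s} → ℕ → (Fin s → Vector r) → ℚ
  kDependence {r} {s} k M =
    ratio (count (λ f → linDependent (λ i → M (f i))) (subsets s (r ℕ.∸ k)))
          (length (subsets s (r ℕ.∸ k)))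

  probDepLE : (r k s : ℕ) → ℚ → ℚ
  probDepLE r k s d =
    ratio (count (λ M → does (kDependence k M ℚ.≤? d)) (matrices r s))
          (length (matrices r s))

  -- P_q(r,k,s,d): the smallest p with  Prob(k-dependence ≤ d) ≥ 1 - p,
  -- which is exactly 1 - Prob(k-dependence ≤ d)
  P : (r k s : ℕ) → ℚ → ℚ
  P r k s d = 1ℚ - probDepLE r k s d

  π : (r k : ℕ) → ℚ
  π r k = ratio (count linIndependent (tuples (nonzeroVectors r) (r ℕ.∸ k)))
                (length (tuples (nonzeroVectors r) (r ℕ.∸ k)))

module Submission where

-- Markov's inequality applied to the k-dependence of a random matrix.
--
-- Let L be the list of size-m subsets of the s column positions (m = r - k,
-- ℓ = |L| > 0), n the number of nonzero vectors of F_q^r, N = n^s and T = n^m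
-- the numbers of matrices and of m-tuples, and D the number of linearly
-- dependent m-tuples, so that 1 - π = D / T.  Writing c(M) for the number of
-- dependent column selections of M, the k-dependence of M is c(M) / ℓ.
--
-- 1. (Double counting.)  Selecting m fixed columns of a uniformly random
--    matrix gives a uniformly random m-tuple, hence  T · Σ_M c(M) = ℓ · N · D,
--    i.e. the expected k-dependence is exactly 1 - π.
-- 2. (Markov.)  Every matrix with k-dependence > d has c(M) > d · ℓ, so the
--    number Bad of such matrices satisfies  Bad · d · ℓ ≤ Σ_M c(M).
-- 3. Since F_q^r has a nonzero vector, N, T > 0 and P = Bad / N; combining
--    1 and 2 gives  Bad · T · d ≤ D · N,  which is  P ≤ (1 - π) / d.

open import Defs
open import Data.Nat using (ℕ; zero; suc; _+_; _*_; _∸_; _^_; _≤_; _<_; z≤n; s≤s; >-nonZero)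
import Data.Nat as ℕ
open import Data.Rational using (ℚ; 0ℚ; 1ℚ; _-_; _÷_; positive)
import Data.Rational as ℚ
open import Data.Rational.Properties using (pos⇒nonZero)

open import Data.Nat.Properties
open import Data.Nat.Tactic.RingSolver using (solve-∀)
open import Data.Fin using (Fin; zero; suc)
open import Data.Bool using (Bool; true; false; not; _∧_; _∨_; T) renaming (_≟_ to _≟ᵇ_)
open import Data.Bool.ListAction using (any)
open import Data.Unit using (⊤; tt)
open import Data.List using (List; []; _∷_; map; _++_; concatMap; length)
open import Data.List.Properties using (length-map; length-++-≤ˡ; filter-some)
open import Data.List.Relation.Unary.All as All using (All; []; _∷_)
import Data.List.Relation.Unary.All.Properties as AllP
open import Data.List.Relation.Unary.Any as Any using (Any)
import Data.List.Relation.Unary.Any.Properties as AnyP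
open import Data.Integer as ℤ using (+[1+_]; -[1+_])
import Data.Integer.Properties as ℤ
import Data.Rational.Unnormalised as U
import Data.Rational.Unnormalised.Properties as U
import Data.Rational.Properties as ℚ
open import Data.Nat.Coprimality using (Coprime)
open import Relation.Binary.PropositionalEquality
open import Relation.Nullary using (¬_; Dec; yes; no)
open import Relation.Nullary.Decidable using (does; dec-false)

-- 1. Finite sums over lists

∑ : ∀ {A : Set} → (A → ℕ) → List A → ℕ
∑ g []       = 0
∑ g (x ∷ xs) = g x + ∑ g xs

χ : Bool → ℕ
χ true  = 1
χ false = 0

count≡∑χ : ∀ {A : Set} (p : A → Bool) xs → count p xs ≡ ∑ (λ x → χ (p x)) xs
count≡∑χ p [] = refl
count≡∑χ p (x ∷ xs) with p x
... | true  = cong suc (count≡∑χ p xs)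
... | false = count≡∑χ p xs

length≡∑1 : ∀ {A : Set} (xs : List A) → length xs ≡ ∑ (λ _ → 1) xs
length≡∑1 []       = refl
length≡∑1 (x ∷ xs) = cong suc (length≡∑1 xs)

∑-cong : ∀ {A : Set} {g h : A → ℕ} → (∀ x → g x ≡ h x) → ∀ xs → ∑ g xs ≡ ∑ h xs
∑-cong e []       = refl
∑-cong e (x ∷ xs) = cong₂ _+_ (e x) (∑-cong e xs)

∑-congAll : ∀ {A : Set} {g h : A → ℕ} {xs} → All (λ x → g x ≡ h x) xs → ∑ g xs ≡ ∑ h xs
∑-congAll []       = refl
∑-congAll (e ∷ es) = cong₂ _+_ e (∑-congAll es)

∑-const : ∀ {A : Set} (c : ℕ) (xs : List A) → ∑ (λ _ → c) xs ≡ length xs * c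
∑-const c []       = refl
∑-const c (x ∷ xs) = cong (c +_) (∑-const c xs)

∑-*ˡ : ∀ {A : Set} (c : ℕ) (g : A → ℕ) xs → ∑ (λ x → c * g x) xs ≡ c * ∑ g xs
∑-*ˡ c g []       = sym (*-zeroʳ c)
∑-*ˡ c g (x ∷ xs) = trans (cong (c * g x +_) (∑-*ˡ c g xs)) (sym (*-distribˡ-+ c (g x) _))

∑-+ : ∀ {A : Set} (g h : A → ℕ) xs → ∑ (λ x → g x + h x) xs ≡ ∑ g xs + ∑ h xs
∑-+ g h []       = refl
∑-+ g h (x ∷ xs) = trans (cong (g x + h x +_) (∑-+ g h xs)) (+-exch (g x) (h x) (∑ g xs) (∑ h xs))
  where
  +-exch : ∀ a b c d → a + b + (c + d) ≡ a + c + (b + d)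
  +-exch = solve-∀

∑-++ : ∀ {A : Set} (g : A → ℕ) xs ys → ∑ g (xs ++ ys) ≡ ∑ g xs + ∑ g ys
∑-++ g []       ys = refl
∑-++ g (x ∷ xs) ys = trans (cong (g x +_) (∑-++ g xs ys)) (sym (+-assoc (g x) _ _))

∑-map : ∀ {A B : Set} (g : B → ℕ) (h : A → B) xs → ∑ g (map h xs) ≡ ∑ (λ x → g (h x)) xs
∑-map g h []       = refl
∑-map g h (x ∷ xs) = cong (g (h x) +_) (∑-map g h xs)

∑-concatMap : ∀ {A B : Set} (g : B → ℕ) (h : A → List B) xs →
  ∑ g (concatMap h xs) ≡ ∑ (λ x → ∑ g (h x)) xs
∑-concatMap g h []       = refl
∑-concatMap g h (x ∷ xs) = trans (∑-++ g (h x) (concatMap h xs)) (cong (∑ g (h x) +_) (∑-concatMap g h xs))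

∑-swap : ∀ {A B : Set} (g : A → B → ℕ) xs ys →
  ∑ (λ x → ∑ (g x) ys) xs ≡ ∑ (λ y → ∑ (λ x → g x y) xs) ys
∑-swap g []       ys = sym (trans (∑-const 0 ys) (*-zeroʳ (length ys)))
∑-swap g (x ∷ xs) ys =
  trans (cong (∑ (g x) ys +_) (∑-swap g xs ys)) (sym (∑-+ (g x) (λ y → ∑ (λ x → g x y) xs) ys))

count-complement : ∀ {A : Set} (p : A → Bool) xs → count p xs + count (λ x → not (p x)) xs ≡ length xs
count-complement p [] = refl
count-complement p (x ∷ xs) with p x
... | true  = cong suc (count-complement p xs)
... | false = trans (+-suc (count p xs) _) (cong suc (count-complement p xs))

rejected : ∀ {A : Set} (a? : Dec A) → T (not (does a?)) → ¬ A
rejected (yes _)  ()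
rejected (no ¬a) _ = ¬a

markov : ∀ {A : Set} (p : A → Bool) (w : A → ℕ) (K : ℕ) → (∀ x → T (not (p x)) → K ≤ w x) →
  ∀ xs → count (λ x → not (p x)) xs * K ≤ ∑ w xs
markov p w K big [] = z≤n
markov p w K big (x ∷ xs) with p x | big x
... | true  | _      = ≤-trans (markov p w K big xs) (m≤n+m (∑ w xs) (w x))
... | false | big-x  = +-mono-≤ (big-x tt) (markov p w K big xs)

-- 2. Uniform tuples and their marginals

-- functions on tuples that only depend on the entries (functions are
-- compared pointwise, as there is no function extensionality)
Extensional : ∀ {A B : Set} {n} → ((Fin n → A) → B) → Set
Extensional {A} {n = n} g = ∀ {u v : Fin n → A} → (∀ i → u i ≡ v i) → g u ≡ g v

cons : ∀ {A : Set} {n} → A → (Fin n → A) → Fin (suc n) → A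
cons x f zero    = x
cons x f (suc i) = f i

∑-tuples : ∀ {A : Set} (xs : List A) n (g : (Fin (suc n) → A) → ℕ) → Extensional g →
  ∑ g (tuples xs (suc n)) ≡ ∑ (λ x → ∑ (λ f → g (cons x f)) (tuples xs n)) xs
∑-tuples xs n g ext = trans (∑-concatMap g _ xs) (∑-cong (λ x → trans (∑-map g _ (tuples xs n))
  (∑-cong (λ f → ext (λ { zero → refl ; (suc i) → refl })) (tuples xs n))) xs)

length-tuples : ∀ {A : Set} (xs : List A) n → length (tuples xs n) ≡ length xs ^ n
length-tuples xs zero    = refl
length-tuples xs (suc n) = begin
  length (tuples xs (suc n))                         ≡⟨ length≡∑1 (tuples xs (suc n)) ⟩
  ∑ (λ _ → 1) (tuples xs (suc n))                    ≡⟨ ∑-tuples xs n (λ _ → 1) (λ _ → refl) ⟩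
  ∑ (λ x → ∑ (λ _ → 1) (tuples xs n)) xs             ≡⟨ ∑-cong (λ x → sym (length≡∑1 (tuples xs n))) xs ⟩
  ∑ (λ x → length (tuples xs n)) xs                  ≡⟨ ∑-const _ xs ⟩
  length xs * length (tuples xs n)                   ≡⟨ cong (length xs *_) (length-tuples xs n) ⟩
  length xs * length xs ^ n                          ∎
  where open ≡-Reasoning

subsets-nonempty : ∀ s m → m ≤ s → 0 < length (subsets s m)
subsets-nonempty s       zero    _         = s≤s z≤n
subsets-nonempty (suc s) (suc m) (s≤s m≤s) =
  ≤-trans (subsets-nonempty s m m≤s) (≤-trans (≤-reflexive (sym (length-map _ (subsets s m)))) (length-++-≤ˡ (map _ (subsets s m))))

tuples-nonempty : ∀ {A : Set} (xs : List A) n → 0 < length xs → 0 < length (tuples xs n)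
tuples-nonempty xs n |xs|>0 = subst (0 <_) (sym (length-tuples xs n)) (m^n>0 (length xs) {{>-nonZero |xs|>0}} n)

module Marginals {A : Set} (xs : List A) where

  n : ℕ
  n = length xs

  -- Selecting the positions f of a uniformly random s-tuple gives a uniformly
  -- random m-tuple: the averages of g ∘ (selection by f) and of g agree.
  Marginal : (s m : ℕ) → (Fin m → Fin s) → Set
  Marginal s m f = ∀ (g : (Fin m → A) → ℕ) → Extensional g →
    n ^ m * ∑ (λ M → g (λ i → M (f i))) (tuples xs s) ≡ n ^ s * ∑ g (tuples xs m)

  marginal-keep : ∀ {s m} {f} (h : Fin (suc m) → Fin (suc s)) →
    h zero ≡ zero → (∀ i → h (suc i) ≡ suc (f i)) → Marginal s m f → Marginal (suc s) (suc m) h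
  marginal-keep {s} {m} {f} h h0 hs marg g ext = begin
    n ^ suc m * ∑ (λ M → g (λ i → M (h i))) (tuples xs (suc s))
      ≡⟨ cong (n ^ suc m *_) (∑-tuples xs s _ (λ e → ext (λ i → e (h i)))) ⟩
    n ^ suc m * ∑ (λ x → ∑ (λ M → g (λ i → cons x M (h i))) (tuples xs s)) xs
      ≡⟨ cong (n ^ suc m *_) (∑-cong (λ x → ∑-cong (λ M → ext (select x M)) (tuples xs s)) xs) ⟩
    n * n ^ m * ∑ (λ x → ∑ (λ M → g (cons x (λ i → M (f i)))) (tuples xs s)) xs
      ≡⟨ *-assoc n (n ^ m) _ ⟩
    n * (n ^ m * ∑ (λ x → ∑ (λ M → g (cons x (λ i → M (f i)))) (tuples xs s)) xs)
      ≡⟨ cong (n *_) (sym (∑-*ˡ (n ^ m) _ xs)) ⟩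
    n * ∑ (λ x → n ^ m * ∑ (λ M → g (cons x (λ i → M (f i)))) (tuples xs s)) xs
      ≡⟨ cong (n *_) (∑-cong (λ x → marg (λ v → g (cons x v)) (λ e → ext (cons-cong x e))) xs) ⟩
    n * ∑ (λ x → n ^ s * ∑ (λ v → g (cons x v)) (tuples xs m)) xs
      ≡⟨ cong (n *_) (∑-*ˡ (n ^ s) _ xs) ⟩
    n * (n ^ s * ∑ (λ x → ∑ (λ v → g (cons x v)) (tuples xs m)) xs)
      ≡⟨ sym (*-assoc n (n ^ s) _) ⟩
    n ^ suc s * ∑ (λ x → ∑ (λ v → g (cons x v)) (tuples xs m)) xs
      ≡⟨ cong (n ^ suc s *_) (sym (∑-tuples xs m g ext)) ⟩
    n ^ suc s * ∑ g (tuples xs (suc m)) ∎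
    where
    open ≡-Reasoning
    select : ∀ x M i → cons x M (h i) ≡ cons x (λ j → M (f j)) i
    select x M zero    = cong (cons x M) h0
    select x M (suc i) = cong (cons x M) (hs i)
    cons-cong : ∀ x {u v : Fin m → A} → (∀ i → u i ≡ v i) → ∀ i → cons x u i ≡ cons x v i
    cons-cong x e zero    = refl
    cons-cong x e (suc i) = e i

  marginal-skip : ∀ {s m} {f} (h : Fin m → Fin (suc s)) →
    (∀ i → h i ≡ suc (f i)) → Marginal s m f → Marginal (suc s) m h
  marginal-skip {s} {m} {f} h hs marg g ext = begin
    n ^ m * ∑ (λ M → g (λ i → M (h i))) (tuples xs (suc s))
      ≡⟨ cong (n ^ m *_) (∑-tuples xs s _ (λ e → ext (λ i → e (h i)))) ⟩
    n ^ m * ∑ (λ x → ∑ (λ M → g (λ i → cons x M (h i))) (tuples xs s)) xs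
      ≡⟨ cong (n ^ m *_) (∑-cong (λ x → ∑-cong (λ M → ext (λ i → cong (cons x M) (hs i))) (tuples xs s)) xs) ⟩
    n ^ m * ∑ (λ x → S) xs
      ≡⟨ cong (n ^ m *_) (∑-const S xs) ⟩
    n ^ m * (n * S)
      ≡⟨ x*[y*z]≡y*[x*z] (n ^ m) n S ⟩
    n * (n ^ m * S)
      ≡⟨ cong (n *_) (marg g ext) ⟩
    n * (n ^ s * ∑ g (tuples xs m))
      ≡⟨ sym (*-assoc n (n ^ s) _) ⟩
    n ^ suc s * ∑ g (tuples xs m) ∎
    where
    open ≡-Reasoning
    S = ∑ (λ M → g (λ i → M (f i))) (tuples xs s)
    x*[y*z]≡y*[x*z] : ∀ x y z → x * (y * z) ≡ y * (x * z)
    x*[y*z]≡y*[x*z] = solve-∀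

  marginal : ∀ s m → All (Marginal s m) (subsets s m)
  marginal s zero = empty ∷ []
    where
    -- the empty selection: both sides count every s-tuple once
    empty : ∀ {f : Fin zero → Fin s} → Marginal s zero f
    empty {f} g ext = begin
      1 * ∑ (λ M → g (λ i → M (f i))) (tuples xs s)   ≡⟨ *-identityˡ _ ⟩
      ∑ (λ M → g (λ i → M (f i))) (tuples xs s)       ≡⟨ ∑-cong (λ M → ext (λ ())) (tuples xs s) ⟩
      ∑ (λ M → g none) (tuples xs s)                  ≡⟨ ∑-const _ (tuples xs s) ⟩
      length (tuples xs s) * g none                   ≡⟨ cong₂ _*_ (length-tuples xs s) (sym (+-identityʳ _)) ⟩
      n ^ s * (g none + 0)                            ≡⟨ cong (λ c → n ^ s * (c + 0)) (ext (λ ())) ⟩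
      n ^ s * ∑ g (tuples xs zero)                    ∎
      where
      open ≡-Reasoning
      none : Fin zero → A
      none ()
  marginal zero    (suc m) = []
  marginal (suc s) (suc m) = AllP.++⁺
    (AllP.map⁺ (All.map (marginal-keep _ refl (λ _ → refl)) (marginal s m)))
    (AllP.map⁺ (All.map (marginal-skip _ (λ _ → refl)) (marginal s (suc m))))

  count-selections : ∀ s m (q : (Fin m → A) → Bool) → Extensional q →
    length (tuples xs m) * ∑ (λ M → count (λ f → q (λ i → M (f i))) (subsets s m)) (tuples xs s)
      ≡ length (subsets s m) * (length (tuples xs s) * count q (tuples xs m))
  count-selections s m q ext = begin
    Tm * ∑ (λ M → count (λ f → q (λ i → M (f i))) L) (tuples xs s)
      ≡⟨ cong (Tm *_) (∑-cong (λ M → count≡∑χ _ L) (tuples xs s)) ⟩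
    Tm * ∑ (λ M → ∑ (λ f → χ (q (λ i → M (f i)))) L) (tuples xs s)
      ≡⟨ cong (Tm *_) (∑-swap (λ M f → χ (q (λ i → M (f i)))) (tuples xs s) L) ⟩
    Tm * ∑ (λ f → ∑ (λ M → χ (q (λ i → M (f i)))) (tuples xs s)) L
      ≡⟨ sym (∑-*ˡ Tm _ L) ⟩
    ∑ (λ f → Tm * ∑ (λ M → χ (q (λ i → M (f i)))) (tuples xs s)) L
      ≡⟨ ∑-congAll (All.map uniform (marginal s m)) ⟩
    ∑ (λ f → Ts * ∑ (λ v → χ (q v)) (tuples xs m)) L
      ≡⟨ ∑-const _ L ⟩
    length L * (Ts * ∑ (λ v → χ (q v)) (tuples xs m))
      ≡⟨ cong (λ c → length L * (Ts * c)) (sym (count≡∑χ q (tuples xs m))) ⟩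
    length L * (Ts * count q (tuples xs m)) ∎
    where
    open ≡-Reasoning
    L  = subsets s m
    Tm = length (tuples xs m)
    Ts = length (tuples xs s)
    uniform : ∀ {f} → Marginal s m f →
      Tm * ∑ (λ M → χ (q (λ i → M (f i)))) (tuples xs s) ≡ Ts * ∑ (λ v → χ (q v)) (tuples xs m)
    uniform {f} marg rewrite length-tuples xs m | length-tuples xs s =
      marg (λ v → χ (q v)) (λ e → cong χ (ext e))

-- 3. Facts about vectors over a finite field

module _ (F : FiniteField) where
  open FiniteField F using (Carrier; 0#; 1#; 0≢1; elements; complete)
    renaming (_+_ to _+F_; _*_ to _*F_; _≟_ to _≟F_)

  lincomb-cong : ∀ {r m} (c : Fin m → Carrier) {u v : Fin m → Vector F r} → (∀ i → u i ≡ v i) →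
    ∀ j → lincomb F c u j ≡ lincomb F c v j
  lincomb-cong {m = zero}  c e j = refl
  lincomb-cong {m = suc m} c e j =
    cong₂ _+F_ (cong (λ w → c zero *F w j) (e zero)) (lincomb-cong (λ i → c (suc i)) (λ i → e (suc i)) j)

  allZero-cong : ∀ {m} {u v : Fin m → Carrier} → (∀ i → u i ≡ v i) → allZero F u ≡ allZero F v
  allZero-cong {zero}  e = refl
  allZero-cong {suc m} e = cong₂ _∧_ (cong (isZero F) (e zero)) (allZero-cong (λ i → e (suc i)))

  linDependent-cong : ∀ {r m} → Extensional (linDependent F {r} {m})
  linDependent-cong e = any-cong (λ c → cong (not (allZero F c) ∧_) (allZero-cong (lincomb-cong c e)))
                                 (tuples elements _)
    where
    any-cong : ∀ {A : Set} {p q : A → Bool} → (∀ x → p x ≡ q x) → ∀ xs → any p xs ≡ any q xs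
    any-cong e []       = refl
    any-cong e (x ∷ xs) = cong₂ _∨_ (e x) (any-cong e xs)

  -- F_q^r has a nonzero vector when r > 0: any vector with first entry 1
  nonzeroVectors-nonempty : ∀ r → 0 < r → 0 < length (nonzeroVectors F r)
  nonzeroVectors-nonempty (suc r) _ =
    filter-some (λ v → allZero F v ≟ᵇ false)
      (AnyP.concatMap⁺ _ (Any.map (λ { refl → AnyP.map⁺ (Any.map (λ _ → leading-one) (inhabited r)) }) (complete 1#)))
    where
    leading-one : ∀ {v} → isZero F 1# ∧ v ≡ false
    leading-one = cong (_∧ _) (dec-false (1# ≟F 0#) (λ 1≡0 → 0≢1 (sym 1≡0)))
    -- the alphabet contains 0#, so tuples of every length exist
    inhabited : ∀ m → Any (λ _ → ⊤) (tuples elements m)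
    inhabited zero    = Any.here tt
    inhabited (suc m) = AnyP.concatMap⁺ _ (Any.map (λ _ → AnyP.map⁺ (inhabited m)) (complete 0#))

-- 4. Proportions as rationals

toℚᵘ-ratio : ∀ c t → ℚ.toℚᵘ (ratio c (suc t)) U.≃ U.mkℚᵘ (ℤ.+ c) t
toℚᵘ-ratio c t = ℚ.toℚᵘ-fromℚᵘ (U.mkℚᵘ (ℤ.+ c) t)

complementᵘ : ∀ B C t → B + C ≡ suc t → U.1ℚᵘ U.- U.mkℚᵘ (ℤ.+ B) t U.≃ U.mkℚᵘ (ℤ.+ C) t
complementᵘ B C t B+C≡N = U.*≡* (trans (cong (ℤ._* ℤ.+ suc t) numerator) (cong (ℤ.+ C ℤ.*_) (sym denominator)))
  where
  open ≡-Reasoning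
  numerator : U.↥ (U.1ℚᵘ U.- U.mkℚᵘ (ℤ.+ B) t) ≡ ℤ.+ C
  numerator = begin
    ℤ.+ 1 ℤ.* ℤ.+ suc t ℤ.+ (ℤ.- ℤ.+ B) ℤ.* ℤ.+ 1  ≡⟨ cong₂ ℤ._+_ (ℤ.*-identityˡ (ℤ.+ suc t)) (ℤ.*-identityʳ (ℤ.- ℤ.+ B)) ⟩
    ℤ.+ suc t ℤ.- ℤ.+ B                           ≡⟨ ℤ.m-n≡m⊖n (suc t) B ⟩
    suc t ℤ.⊖ B                                   ≡⟨ ℤ.⊖-≥ (subst (B ≤_) B+C≡N (m≤m+n B C)) ⟩
    ℤ.+ (suc t ∸ B)                               ≡⟨ cong (λ N → ℤ.+ (N ∸ B)) (sym B+C≡N) ⟩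
    ℤ.+ (B + C ∸ B)                               ≡⟨ cong ℤ.+_ (m+n∸m≡n B C) ⟩
    ℤ.+ C                                         ∎
  denominator : U.↧ (U.1ℚᵘ U.- U.mkℚᵘ (ℤ.+ B) t) ≡ ℤ.+ suc t
  denominator = cong ℤ.+_ (*-identityˡ (suc t))

ratio-complement : ∀ B C N → 0 < N → B + C ≡ N → 1ℚ - ratio B N ≡ ratio C N
ratio-complement B C (suc t) _ B+C≡N = ℚ.toℚᵘ-injective (begin
  ℚ.toℚᵘ (1ℚ - ratio B (suc t))            ≈⟨ ℚ.toℚᵘ-homo-+ 1ℚ (ℚ.- ratio B (suc t)) ⟩
  U.1ℚᵘ U.+ ℚ.toℚᵘ (ℚ.- ratio B (suc t))   ≈⟨ U.+-congʳ U.1ℚᵘ (U.≃-trans (ℚ.toℚᵘ-homo‿- (ratio B (suc t)))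
                                                                       (U.-‿cong (toℚᵘ-ratio B t))) ⟩
  U.1ℚᵘ U.- U.mkℚᵘ (ℤ.+ B) t               ≈⟨ complementᵘ B C t B+C≡N ⟩
  U.mkℚᵘ (ℤ.+ C) t                         ≈⟨ U.≃-sym (toℚᵘ-ratio C t) ⟩
  ℚ.toℚᵘ (ratio C (suc t))                 ∎)
  where open U.≃-Reasoning

module _ (a b : ℕ) .(cp : Coprime (suc a) (suc b)) where

  private
    d : ℚ
    d = ℚ.mkℚ +[1+ a ] b cp

  exceeds : ∀ c ℓ → 0 < ℓ → ¬ (ratio c ℓ ℚ.≤ d) → suc a * ℓ ≤ suc b * c
  exceeds c (suc l) _ c/ℓ≰d
    with U.≤-respʳ-≃ (toℚᵘ-ratio c l) (ℚ.toℚᵘ-mono-≤ (ℚ.<⇒≤ (ℚ.≰⇒> c/ℓ≰d)))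
  ... | U.*≤* cross = subst (suc a * suc l ≤_) (*-comm c (suc b))
          (ℤ.drop‿+≤+ (subst₂ ℤ._≤_ (sym (ℤ.pos-* (suc a) (suc l))) (sym (ℤ.pos-* c (suc b))) cross))

  ratio-≤-÷ : ∀ x N c T → 0 < N → 0 < T → x * T * suc a ≤ c * suc b * N → ratio x N ℚ.≤ ratio c T ÷ d
  ratio-≤-÷ x (suc n) c (suc t) _ _ cross = ℚ.toℚᵘ-cancel-≤
    (U.≤-respˡ-≃ (U.≃-sym (toℚᵘ-ratio x n)) (U.≤-respʳ-≃ (U.≃-sym quotient) (U.*≤* crossℤ)))
    where
    quotient : ℚ.toℚᵘ (ratio c (suc t) ÷ d) U.≃ U.mkℚᵘ (ℤ.+ c) t U.* U.mkℚᵘ +[1+ b ] a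
    quotient = U.≃-trans (ℚ.toℚᵘ-homo-* (ratio c (suc t)) _) (U.*-cong (toℚᵘ-ratio c t) U.≃-refl)
    crossℤ : ℤ.+ x ℤ.* ℤ.+ (suc t * suc a) ℤ.≤ (ℤ.+ c ℤ.* ℤ.+ suc b) ℤ.* ℤ.+ suc n
    crossℤ rewrite sym (ℤ.pos-* x (suc t * suc a)) | sym (ℤ.pos-* c (suc b)) | sym (ℤ.pos-* (c * suc b) (suc n)) =
      ℤ.+≤+ (subst (_≤ c * suc b * suc n) (*-assoc x (suc t) (suc a)) cross)

-- 5. The bound

clear-denominators : ∀ {bad α β S T N D} ℓ → 0 < ℓ →
  bad * (α * ℓ) ≤ β * S → T * S ≡ ℓ * (N * D) → bad * T * α ≤ D * β * N
clear-denominators {bad} {α} {β} {S} {T} {N} {D} ℓ ℓ>0 markov-ineq double-count =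
  *-cancelˡ-≤ ℓ {{>-nonZero ℓ>0}} (begin
    ℓ * (bad * T * α)      ≡⟨ regroupˡ ℓ bad T α ⟩
    bad * (α * ℓ) * T      ≤⟨ *-monoˡ-≤ T markov-ineq ⟩
    β * S * T              ≡⟨ regroupᵐ β S T ⟩
    β * (T * S)            ≡⟨ cong (β *_) double-count ⟩
    β * (ℓ * (N * D))      ≡⟨ regroupʳ β ℓ N D ⟩
    ℓ * (D * β * N)        ∎)
  where
  open ≤-Reasoning
  regroupˡ : ∀ l x t y → l * (x * t * y) ≡ x * (y * l) * t
  regroupˡ = solve-∀
  regroupᵐ : ∀ y x t → y * x * t ≡ y * (t * x)
  regroupᵐ = solve-∀
  regroupʳ : ∀ y l x z → y * (l * (x * z)) ≡ l * (z * y * x)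
  regroupʳ = solve-∀

module Counting (F : FiniteField) (r k s : ℕ) where

  m : ℕ
  m = r ∸ k

  vectors : List (Vector F r)
  vectors = nonzeroVectors F r

  selections : List (Fin m → Fin s)
  selections = subsets s m

  #matrices #tuples #dependent : ℕ
  #matrices  = length (matrices F r s)
  #tuples    = length (tuples vectors m)
  #dependent = count (linDependent F) (tuples vectors m)

  dependentSelections : (Fin s → Vector F r) → ℕ
  dependentSelections M = count (λ f → linDependent F (λ i → M (f i))) selections

  -- the mean k-dependence of a random matrix is #dependent / #tuples = 1 - π
  mean-dependence : #tuples * ∑ dependentSelections (matrices F r s) ≡ length selections * (#matrices * #dependent)
  mean-dependence = Marginals.count-selections vectors s m (linDependent F) (linDependent-cong F)

  module _ (a b : ℕ) .(cp : Coprime (suc a) (suc b)) where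

    good : (Fin s → Vector F r) → Bool
    good M = does (kDependence F k M ℚ.≤? ℚ.mkℚ +[1+ a ] b cp)

    #bad : ℕ
    #bad = count (λ M → not (good M)) (matrices F r s)

    bad-bound : m ≤ s → #bad * #tuples * suc a ≤ #dependent * suc b * #matrices
    bad-bound m≤s = clear-denominators {#bad} {suc a} {suc b} {∑ dependentSelections (matrices F r s)}
                                       {#tuples} {#matrices} {#dependent} (length selections) ℓ>0
      (≤-trans (markov good (λ M → suc b * dependentSelections M) (suc a * length selections) exceeding (matrices F r s))
               (≤-reflexive (∑-*ˡ (suc b) dependentSelections (matrices F r s))))
      mean-dependence
      where
      ℓ>0 : 0 < length selections
      ℓ>0 = subsets-nonempty s m m≤s
      exceeding : ∀ M → T (not (good M)) → suc a * length selections ≤ suc b * dependentSelections M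
      exceeding M bad = exceeds a b cp (dependentSelections M) (length selections) ℓ>0
                          (rejected (kDependence F k M ℚ.≤? ℚ.mkℚ +[1+ a ] b cp) bad)

-- Corollary 2:  P_q(r,k,s,d) ≤ (1 - π_{q,r,k}) / d.  The argument works for
-- every d > 0.
corollary2 : (F : FiniteField) (r k s : ℕ) (d : ℚ)
    → k ℕ.< r → r ∸ k ℕ.≤ s
    → (0<d : 0ℚ ℚ.< d) → d ℚ.≤ 1ℚ
    → P F r k s d ℚ.≤ _÷_ (1ℚ - π F r k) d {{pos⇒nonZero d {{positive 0<d}}}}
corollary2 F r k s (ℚ.mkℚ (ℤ.+ zero) _ _) _ _ (ℚ.*<* (ℤ.+<+ ())) _
corollary2 F r k s (ℚ.mkℚ -[1+ _ ] _ _)   _ _ (ℚ.*<* ())         _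
corollary2 F r k s d@(ℚ.mkℚ +[1+ a ] b cp) k<r m≤s _ _ = begin
  P F r k s d
    ≡⟨ ratio-complement _ (#bad a b cp) #matrices N>0 (count-complement (good a b cp) (matrices F r s)) ⟩
  ratio (#bad a b cp) #matrices
    ≤⟨ ratio-≤-÷ a b cp (#bad a b cp) #matrices #dependent #tuples N>0 T>0 (bad-bound a b cp m≤s) ⟩
  ratio #dependent #tuples ÷ d
    ≡⟨ cong (_÷ d) (sym (ratio-complement _ _ #tuples T>0 independent+dependent)) ⟩
  (1ℚ - π F r k) ÷ d ∎
  where
  open Counting F r k s
  open ℚ.≤-Reasoning
  vectors>0 : 0 < length vectors
  vectors>0 = nonzeroVectors-nonempty F r (≤-trans (s≤s z≤n) k<r)
  N>0 : 0 < #matrices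
  N>0 = tuples-nonempty vectors s vectors>0
  T>0 : 0 < #tuples
  T>0 = tuples-nonempty vectors m vectors>0
  independent+dependent : count (linIndependent F) (tuples vectors m) + #dependent ≡ #tuples
  independent+dependent = trans (+-comm _ #dependent) (count-complement (linDependent F) (tuples vectors m))
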